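{- For every integer $n \ge 3$, \[ d(n,3) = \begin{cases} \left\lfloor \frac{4n}{7}\right\rfloor & \text{ if } n \equiv 3,5 \pmod {7},\\ \left\lfloor \frac{4n}{7}\right\rfloor-1& \text{ otherwise.} \end{cases} \]
   Context: All codes are binary linear codes. An $[n,k]$ code is a $k$-dimensional subspace of $\mathbb{F}_2^n$; an $[n,k,d]$ code is one with minimum nonzero Hamming weight $d$. The dual $C^\perp$ is taken with respect to the standard inner product. A code $C$ is LCD (linear complementary dual) if $C \cap C^\perp = \{\mathbf{0}_n\}$. $d(n,k)$ denotes the largest minimum weight among all binary LCD $[n,k]$ codes. -}

module Defs where

open import Data.Bool using (Bool; true; false; _xor_; _∧_)
open import Data.Nat using (ℕ; zero; suc; _+_; _*_; _≤_; _∸_; _/_; _%_)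
open import Data.Vec using (Vec; []; _∷_; replicate; zipWith; foldr)
open import Data.Product using (Σ; ∃; _×_; _,_)
open import Relation.Binary.PropositionalEquality using (_≡_; _≢_)
open import Relation.Nullary using (¬_)

-- Vectors of F₂ⁿ, with F₂ = Bool (false = 0, true = 1, xor = +, ∧ = ·).
Word : ℕ → Set
Word n = Vec Bool n

zero-word : (n : ℕ) → Word n
zero-word n = replicate n false

_⊕_ : {n : ℕ} → Word n → Word n → Word n
_⊕_ = zipWith _xor_

_·_ : {n : ℕ} → Word n → Word n → Bool
[] · [] = false
(x ∷ xs) · (y ∷ ys) = (x ∧ y) xor (xs · ys)

wt : {n : ℕ} → Word n → ℕ
wt [] = 0
wt (true ∷ xs) = suc (wt xs)
wt (false ∷ xs) = wt xs

comb : {n k : ℕ} → Vec (Word n) k → Vec Bool k → Word n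
comb {n} [] [] = zero-word n
comb (g ∷ gs) (true ∷ cs) = g ⊕ comb gs cs
comb (g ∷ gs) (false ∷ cs) = comb gs cs

-- A binary [n,k] code is given by k linearly independent generators
-- (rows of a generator matrix); the code is their F₂-span.
LinIndep : {n k : ℕ} → Vec (Word n) k → Set
LinIndep {n} {k} G = (c : Vec Bool k) → comb G c ≡ zero-word n → c ≡ replicate k false

_∈C_ : {n k : ℕ} → Word n → Vec (Word n) k → Set
x ∈C G = ∃ λ c → comb G c ≡ x

_∈C⊥_ : {n k : ℕ} → Word n → Vec (Word n) k → Set
x ∈C⊥ G = ∀ y → y ∈C G → x · y ≡ false

IsLCD : {n k : ℕ} → Vec (Word n) k → Set
IsLCD {n} G = ∀ x → x ∈C G → x ∈C⊥ G → x ≡ zero-word n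

MinWt≥ : {n k : ℕ} → Vec (Word n) k → ℕ → Set
MinWt≥ {n} G d = ∀ x → x ∈C G → x ≢ zero-word n → d ≤ wt x

MinWt≤ : {n k : ℕ} → Vec (Word n) k → ℕ → Set
MinWt≤ {n} G d = ∃ λ x → x ∈C G × x ≢ zero-word n × wt x ≤ d

-- d(n,k) = D : D is the largest minimum weight among binary LCD [n,k] codes
IsLCDOptimal : ℕ → ℕ → ℕ → Set
IsLCDOptimal n k D =
  (Σ (Vec (Word n) k) λ G → LinIndep G × IsLCD G × MinWt≥ G D × MinWt≤ G D)
  × ((G : Vec (Word n) k) → LinIndep G → IsLCD G → MinWt≤ G D)

dn3 : ℕ → ℕ
dn3 n with n % 7
... | 3 = (4 * n) / 7
... | 5 = (4 * n) / 7
... | _ = (4 * n) / 7 ∸ 1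

-- An [n,3] code with generator matrix G is LCD iff its Gram matrix G Gᵀ is nonsingular over F₂.
--
-- Lower bound: the [7,3,4] simplex code is self-orthogonal and all its nonzero codewords have
-- weight 4, so juxtaposing it with an LCD [n,3,d] code gives an LCD [n+7,3,d+4] code; seven small
-- codes (n = 3, …, 9), checked by exhaustive search, start the induction.
--
-- Upper bound: every coordinate is nonzero in at most four of the seven nonzero codewords, so their
-- weights sum to at most 4n and some weight is at most ⌊4n/7⌋. Suppose all seven weights are at
-- least L = ⌊4n/7⌋ and the slack S = 4n − 7L is at most 4, which is the case exactly when
-- n ≢ 3, 5 (mod 7). Then the weights exceed L by amounts summing to at most S, and L ≡ S (mod 4).
-- As g · h is the parity of |g ∧ h| and wt g + wt h = wt (g ⊕ h) + 2 |g ∧ h|, the weights modulo 4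
-- determine G Gᵀ, and a finite check over all such excesses shows that G Gᵀ is singular.

module Submission where

open import Defs
open import Data.Nat using (ℕ; _≤_)
open import Data.Nat using (zero; suc; _+_; _*_; _∸_; _/_; _%_; _<_; _≤?_; _≤ᵇ_; z≤n; s≤s; NonZero)
open import Data.Nat.Properties
open import Data.Nat.DivMod using (m≡m%n+[m/n]*n; m%n<n; %-distribˡ-*; +-distrib-/-∣ˡ; m≥n⇒m/n>0)
open import Data.Nat.Divisibility using (divides)
open import Data.Nat.Tactic.RingSolver using (solve-∀)
open import Data.Bool using (Bool; true; false; not; _∧_; _xor_; T)
open import Data.Bool.Properties
  using (∧-comm; ∧-distribˡ-xor; xor-assoc; xor-identityʳ; xor-∧-commutativeRing; T-∧)
  renaming (_≟_ to _≟ᵇ_)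
open import Data.Unit using (tt)
open import Data.Vec using (Vec; []; _∷_; [_]; replicate; zipWith; map; sum; _++_)
open import Data.Vec.Properties using (≡-dec; map-∘; map-cong; map-replicate; zipWith-identityʳ; zipWith-++; ++-injectiveʳ)
open import Data.Vec.Relation.Unary.All as All using (All; []; _∷_)
open import Data.Vec.Relation.Unary.All.Properties using (map⁺)
open import Data.List as List using (List)
open import Data.List.Membership.Propositional using (_∈_)
open import Data.List.Membership.Propositional.Properties using (∈-map⁺; ∈-++⁺ˡ; ∈-++⁺ʳ)
open import Data.List.Relation.Unary.All as ListAll using (all?)
open import Data.List.Relation.Unary.Any using (Any; here; any?; satisfied)
open import Data.Product using (Σ; ∃; _×_; _,_; proj₁; proj₂)
open import Data.Sum using (_⊎_; inj₁; inj₂; map₂)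
open import Data.Empty using (⊥-elim)
open import Function using (_∘_; Equivalence)
open import Relation.Binary.PropositionalEquality
  using (_≡_; _≢_; refl; sym; trans; cong; cong₂; subst; module ≡-Reasoning)
open import Relation.Nullary using (¬_; Dec; yes; no; contradiction)
open import Relation.Nullary.Decidable using (True; toWitness; isYes; ¬?; _×-dec_; _→-dec_)
open import Relation.Unary using (Decidable)
open import Algebra.Bundles using (CommutativeRing)
open import Algebra.Properties.CommutativeSemigroup
  (CommutativeRing.+-commutativeSemigroup xor-∧-commutativeRing) using () renaming (interchange to xor-interchange)
open import Algebra.Properties.CommutativeSemigroup +-commutativeSemigroup using () renaming (interchange to +-interchange)

variable
  k m n w D L : ℕ

pattern O = false
pattern I = true

infix 4 _≟ʷ_

_≟ʷ_ : (x y : Word n) → Dec (x ≡ y)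
_≟ʷ_ = ≡-dec _≟ᵇ_

wt-zero : ∀ n → wt (zero-word n) ≡ 0
wt-zero zero = refl
wt-zero (suc n) = wt-zero n

wt-++ : (x : Word m) (y : Word n) → wt (x ++ y) ≡ wt x + wt y
wt-++ [] y = refl
wt-++ (I ∷ x) y = cong suc (wt-++ x y)
wt-++ (O ∷ x) y = wt-++ x y

zero-word-++ : ∀ m n → zero-word (m + n) ≡ zero-word m ++ zero-word n
zero-word-++ zero n = refl
zero-word-++ (suc m) n = cong (O ∷_) (zero-word-++ m n)

⊕-identityʳ : (x : Word n) → x ⊕ zero-word n ≡ x
⊕-identityʳ = zipWith-identityʳ xor-identityʳ

·-comm : (x y : Word n) → x · y ≡ y · x
·-comm [] [] = refl
·-comm (a ∷ x) (b ∷ y) = cong₂ _xor_ (∧-comm a b) (·-comm x y)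

·-zeroˡ : (x : Word n) → zero-word n · x ≡ false
·-zeroˡ [] = refl
·-zeroˡ (a ∷ x) = ·-zeroˡ x

·-zeroʳ : (x : Word n) → x · zero-word n ≡ false
·-zeroʳ x = trans (·-comm x _) (·-zeroˡ x)

·-distribˡ-⊕ : (x y z : Word n) → x · (y ⊕ z) ≡ (x · y) xor (x · z)
·-distribˡ-⊕ [] [] [] = refl
·-distribˡ-⊕ (a ∷ x) (b ∷ y) (c ∷ z) = begin
  (a ∧ (b xor c)) xor (x · (y ⊕ z))               ≡⟨ cong₂ _xor_ (∧-distribˡ-xor a b c) (·-distribˡ-⊕ x y z) ⟩
  ((a ∧ b) xor (a ∧ c)) xor ((x · y) xor (x · z)) ≡⟨ xor-interchange (a ∧ b) (a ∧ c) (x · y) (x · z) ⟩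
  ((a ∧ b) xor (x · y)) xor ((a ∧ c) xor (x · z)) ∎
  where open ≡-Reasoning

·-++ : (x x′ : Word m) (y y′ : Word n) → (x ++ y) · (x′ ++ y′) ≡ (x · x′) xor (y · y′)
·-++ [] [] y y′ = refl
·-++ (a ∷ x) (a′ ∷ x′) y y′ =
  trans (cong ((a ∧ a′) xor_) (·-++ x x′ y y′)) (sym (xor-assoc (a ∧ a′) (x · x′) (y · y′)))

·-nondegenerate : (v : Word k) → (∀ c → c · v ≡ false) → v ≡ zero-word k
·-nondegenerate [] _ = refl
·-nondegenerate (b ∷ v) v⊥ = cong₂ _∷_ b≡false (·-nondegenerate v (v⊥ ∘ (O ∷_)))
  where
  open ≡-Reasoning
  b≡false : b ≡ false
  b≡false = begin
    b                        ≡⟨ xor-identityʳ b ⟨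
    b xor false              ≡⟨ cong (b xor_) (·-zeroˡ v) ⟨
    b xor (zero-word _ · v)  ≡⟨ v⊥ (I ∷ zero-word _) ⟩
    false                    ∎

allWords : ∀ k → List (Word k)
allWords zero = List.[ [] ]
allWords (suc k) = List.map (O ∷_) (allWords k) List.++ List.map (I ∷_) (allWords k)

∈-allWords : (c : Word k) → c ∈ allWords k
∈-allWords [] = here refl
∈-allWords (O ∷ c) = ∈-++⁺ˡ (∈-map⁺ (O ∷_) (∈-allWords c))
∈-allWords {suc k} (I ∷ c) = ∈-++⁺ʳ (List.map (O ∷_) (allWords k)) (∈-map⁺ (I ∷_) (∈-allWords c))

byExhaustion : {P : Word k → Set} (P? : Decidable P) → {True (all? P? (allWords k))} → ∀ c → P c
byExhaustion {k} P? {ok} c = ListAll.lookup (toWitness {a? = all? P? (allWords k)} ok) (∈-allWords c)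

allUpTo : ℕ → (ℕ → Bool) → Bool
allUpTo zero p = p zero
allUpTo (suc S) p = p zero ∧ allUpTo S (p ∘ suc)

allUpTo-sound : ∀ S {p x} → T (allUpTo S p) → x ≤ S → T (p x)
allUpTo-sound zero ok z≤n = ok
allUpTo-sound (suc S) {x = zero} ok _ = proj₁ (Equivalence.to T-∧ ok)
allUpTo-sound (suc S) {x = suc x} ok (s≤s x≤S) = allUpTo-sound S (proj₂ (Equivalence.to T-∧ ok)) x≤S

allWithSum≤ : (k S : ℕ) → (Vec ℕ k → Bool) → Bool
allWithSum≤ zero S p = p []
allWithSum≤ (suc k) S p = allUpTo S λ x → allWithSum≤ k (S ∸ x) (p ∘ (x ∷_))

allWithSum≤-sound : ∀ k S {p} (e : Vec ℕ k) → T (allWithSum≤ k S p) → sum e ≤ S → T (p e)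
allWithSum≤-sound zero S [] ok _ = ok
allWithSum≤-sound (suc k) S (x ∷ e) ok x+e≤S =
  allWithSum≤-sound k (S ∸ x) e (allUpTo-sound S ok (m+n≤o⇒m≤o x x+e≤S))
    (m+n≤o⇒m≤o∸n (sum e) (subst (_≤ S) (+-comm x (sum e)) x+e≤S))

-- Gram matrices and the LCD criterion

infixl 7 _*ᵥ_

_*ᵥ_ : Vec (Word n) k → Word n → Word k
M *ᵥ x = map (x ·_) M

Gram : Vec (Word n) k → Vec (Word k) k
Gram G = map (G *ᵥ_) G

Nonsingular : Vec (Word k) k → Set
Nonsingular {k} M = ∀ c → M *ᵥ c ≡ zero-word k → c ≡ zero-word k

Singular : Vec (Word k) k → Set
Singular {k} M = ∃ λ c → c ≢ zero-word k × M *ᵥ c ≡ zero-word k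

singular? : (M : Vec (Word k) k) → Dec (Any (λ c → c ≢ zero-word k × M *ᵥ c ≡ zero-word k) (allWords k))
singular? {k} M = any? (λ c → ¬? (c ≟ʷ zero-word k) ×-dec (M *ᵥ c ≟ʷ zero-word k)) (allWords k)

comb-zero : (G : Vec (Word n) k) → comb G (zero-word k) ≡ zero-word n
comb-zero [] = refl
comb-zero (g ∷ G) = comb-zero G

coeff≢0 : (G : Vec (Word n) k) {c : Word k} → comb G c ≢ zero-word n → c ≢ zero-word k
coeff≢0 G nz refl = nz (comb-zero G)

·-comb : (x : Word n) (G : Vec (Word n) k) (c : Word k) → x · comb G c ≡ c · (G *ᵥ x)
·-comb x [] [] = ·-zeroʳ x
·-comb x (g ∷ G) (I ∷ c) = trans (·-distribˡ-⊕ x g (comb G c)) (cong ((x · g) xor_) (·-comb x G c))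
·-comb x (g ∷ G) (O ∷ c) = ·-comb x G c

*ᵥ-comb : (G : Vec (Word n) k) (c : Word k) → G *ᵥ comb G c ≡ Gram G *ᵥ c
*ᵥ-comb G c = begin
  map (comb G c ·_) G           ≡⟨ map-cong (λ g → trans (·-comm (comb G c) g) (·-comb g G c)) G ⟩
  map (λ g → c · (G *ᵥ g)) G    ≡⟨ map-∘ (c ·_) (G *ᵥ_) G ⟩
  map (c ·_) (map (G *ᵥ_) G)    ∎
  where open ≡-Reasoning

comb-·-comb : (G : Vec (Word n) k) (c d : Word k) → comb G c · comb G d ≡ d · (Gram G *ᵥ c)
comb-·-comb G c d = trans (·-comb (comb G c) G d) (cong (d ·_) (*ᵥ-comb G c))

∈C⊥⇒*ᵥ≡0 : (x : Word n) (G : Vec (Word n) k) → x ∈C⊥ G → G *ᵥ x ≡ zero-word k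
∈C⊥⇒*ᵥ≡0 x G x⊥ = ·-nondegenerate (G *ᵥ x) λ c → trans (sym (·-comb x G c)) (x⊥ (comb G c) (c , refl))

*ᵥ≡0⇒∈C⊥ : (x : Word n) (G : Vec (Word n) k) → G *ᵥ x ≡ zero-word k → x ∈C⊥ G
*ᵥ≡0⇒∈C⊥ x G Gx≡0 .(comb G c) (c , refl) = begin
  x · comb G c      ≡⟨ ·-comb x G c ⟩
  c · (G *ᵥ x)      ≡⟨ cong (c ·_) Gx≡0 ⟩
  c · zero-word _   ≡⟨ ·-zeroʳ c ⟩
  false             ∎
  where open ≡-Reasoning

lcd⇒nonsingular : (G : Vec (Word n) k) → LinIndep G → IsLCD G → Nonsingular (Gram G)
lcd⇒nonsingular G li lcd c Gram·c≡0 =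
  li c (lcd (comb G c) (c , refl) (*ᵥ≡0⇒∈C⊥ (comb G c) G (trans (*ᵥ-comb G c) Gram·c≡0)))

nonsingular⇒lcd : (G : Vec (Word n) k) → Nonsingular (Gram G) → IsLCD G
nonsingular⇒lcd G ns .(comb G c) (c , refl) x⊥ =
  trans (cong (comb G) (ns c (trans (sym (*ᵥ-comb G c)) (∈C⊥⇒*ᵥ≡0 (comb G c) G x⊥)))) (comb-zero G)

Weights≥ : Vec (Word n) k → ℕ → Set
Weights≥ {k = k} G D = ∀ c → c ≢ zero-word k → D ≤ wt (comb G c)

LCDCode : ℕ → ℕ → ℕ → Set
LCDCode n k D = Σ (Vec (Word n) k) λ G → LinIndep G × IsLCD G × MinWt≥ G D × MinWt≤ G D

weights≥⇒minWt≥ : (G : Vec (Word n) k) → Weights≥ G D → MinWt≥ G D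
weights≥⇒minWt≥ G heavy .(comb G c) (c , refl) nz = heavy c (coeff≢0 G nz)

weights≥⇒linIndep : (G : Vec (Word n) k) → 1 ≤ D → Weights≥ G D → LinIndep G
weights≥⇒linIndep {n} {k} G 1≤D heavy c eq with c ≟ʷ zero-word k
... | yes c≡0 = c≡0
... | no c≢0 = contradiction (subst (1 ≤_) (trans (cong wt eq) (wt-zero n)) (≤-trans 1≤D (heavy c c≢0))) λ ()

light⇒minWt≤ : (G : Vec (Word n) k) → LinIndep G → (c : Word k) → c ≢ zero-word k → wt (comb G c) ≤ D → MinWt≤ G D
light⇒minWt≤ G li c c≢0 light = comb G c , (c , refl) , (λ eq → c≢0 (li c eq)) , light

weight≥? : (G : Vec (Word n) k) (D : ℕ) → Decidable (λ c → c ≢ zero-word k → D ≤ wt (comb G c))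
weight≥? G D c = ¬? (c ≟ʷ _) →-dec (D ≤? wt (comb G c))

kernelTrivial? : (M : Vec (Word k) k) → Decidable (λ c → M *ᵥ c ≡ zero-word k → c ≡ zero-word k)
kernelTrivial? M c = (M *ᵥ c ≟ʷ _) →-dec (c ≟ʷ _)

light? : (G : Vec (Word n) k) (D : ℕ) → Decidable (λ c → c ≢ zero-word k × wt (comb G c) ≤ D)
light? G D c = ¬? (c ≟ʷ _) ×-dec (wt (comb G c) ≤? D)

lcdCodeByExhaustion : (G : Vec (Word n) k) (D : ℕ) → {True (1 ≤? D)} →
  {True (all? (weight≥? G D) (allWords k))} → {True (all? (kernelTrivial? (Gram G)) (allWords k))} →
  {True (any? (light? G D) (allWords k))} → LCDCode n k D
lcdCodeByExhaustion G D {1≤D} {heavy} {ns} {light} =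
  G , li , nonsingular⇒lcd G (byExhaustion (kernelTrivial? (Gram G)) {ns}) , weights≥⇒minWt≥ G heavy′ , light′
  where
  heavy′ = byExhaustion (weight≥? G D) {heavy}
  li = weights≥⇒linIndep G (toWitness 1≤D) heavy′

  light′ : MinWt≤ G D
  light′ with satisfied (toWitness {a? = any? (light? G D) (allWords _)} light)
  ... | c , c≢0 , wt≤D = light⇒minWt≤ G li c c≢0 wt≤D

-- Juxtaposition with a self-orthogonal code

infixr 5 _∣_

_∣_ : Vec (Word m) k → Vec (Word n) k → Vec (Word (m + n)) k
_∣_ = zipWith _++_

comb-∣ : (H : Vec (Word m) k) (G : Vec (Word n) k) (c : Word k) → comb (H ∣ G) c ≡ comb H c ++ comb G c
comb-∣ {m} {n = n} [] [] [] = zero-word-++ m n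
comb-∣ (h ∷ H) (g ∷ G) (I ∷ c) =
  trans (cong ((h ++ g) ⊕_) (comb-∣ H G c)) (zipWith-++ _xor_ h g (comb H c) (comb G c))
comb-∣ (h ∷ H) (g ∷ G) (O ∷ c) = comb-∣ H G c

selfOrthogonal : (H : Vec (Word m) k) → Gram H ≡ replicate k (zero-word k) → ∀ c d → comb H c · comb H d ≡ false
selfOrthogonal {k = k} H Gram≡0 c d = begin
  comb H c · comb H d                          ≡⟨ comb-·-comb H c d ⟩
  d · (Gram H *ᵥ c)                            ≡⟨ cong (λ M → d · (M *ᵥ c)) Gram≡0 ⟩
  d · map (c ·_) (replicate k (zero-word k))   ≡⟨ cong (d ·_) (map-replicate (c ·_) (zero-word k) k) ⟩
  d · replicate k (c · zero-word k)            ≡⟨ cong (λ b → d · replicate k b) (·-zeroʳ c) ⟩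
  d · zero-word k                              ≡⟨ ·-zeroʳ d ⟩
  false                                        ∎
  where open ≡-Reasoning

comb-∣≡0 : (H : Vec (Word m) k) (G : Vec (Word n) k) (c : Word k) →
  comb (H ∣ G) c ≡ zero-word (m + n) → comb G c ≡ zero-word n
comb-∣≡0 {m} {n = n} H G c eq =
  ++-injectiveʳ (comb H c) (zero-word m) (trans (sym (comb-∣ H G c)) (trans eq (zero-word-++ m n)))

wt-comb-∣ : (H : Vec (Word m) k) (G : Vec (Word n) k) (c : Word k) →
  wt (comb (H ∣ G) c) ≡ wt (comb H c) + wt (comb G c)
wt-comb-∣ H G c = trans (cong wt (comb-∣ H G c)) (wt-++ (comb H c) (comb G c))

·-comb-∣ : (H : Vec (Word m) k) (G : Vec (Word n) k) → Gram H ≡ replicate k (zero-word k) →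
  ∀ c d → comb (H ∣ G) c · comb (H ∣ G) d ≡ comb G c · comb G d
·-comb-∣ H G Gram≡0 c d = begin
  comb (H ∣ G) c · comb (H ∣ G) d                  ≡⟨ cong₂ _·_ (comb-∣ H G c) (comb-∣ H G d) ⟩
  (comb H c ++ comb G c) · (comb H d ++ comb G d)  ≡⟨ ·-++ (comb H c) (comb H d) (comb G c) (comb G d) ⟩
  (comb H c · comb H d) xor (comb G c · comb G d)  ≡⟨ cong (_xor (comb G c · comb G d)) (selfOrthogonal H Gram≡0 c d) ⟩
  comb G c · comb G d                              ∎
  where open ≡-Reasoning

juxtapose-isLCD : (H : Vec (Word m) k) (G : Vec (Word n) k) → Gram H ≡ replicate k (zero-word k) →
  LinIndep G → IsLCD G → IsLCD (H ∣ G)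
juxtapose-isLCD H G Gram≡0 li lcd .(comb (H ∣ G) c) (c , refl) x⊥ =
  trans (cong (comb (H ∣ G)) c≡0) (comb-zero (H ∣ G))
  where
  suffix⊥ : comb G c ∈C⊥ G
  suffix⊥ .(comb G d) (d , refl) = trans (sym (·-comb-∣ H G Gram≡0 c d)) (x⊥ (comb (H ∣ G) d) (d , refl))

  c≡0 = li c (lcd (comb G c) (c , refl) suffix⊥)

juxtapose-lcd : (H : Vec (Word m) k) → Gram H ≡ replicate k (zero-word k) →
  (∀ c → c ≢ zero-word k → wt (comb H c) ≡ w) → LCDCode n k D → LCDCode (m + n) k (w + D)
juxtapose-lcd {k = k} {w} {D = D} H Gram≡0 constWt (G , li , lcd , ge , le) =
  H ∣ G , li′ , juxtapose-isLCD H G Gram≡0 li lcd , weights≥⇒minWt≥ (H ∣ G) heavy , light le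
  where
  li′ : LinIndep (H ∣ G)
  li′ c eq = li c (comb-∣≡0 H G c eq)

  wt-∣ : ∀ c → c ≢ zero-word k → wt (comb (H ∣ G) c) ≡ w + wt (comb G c)
  wt-∣ c c≢0 = trans (wt-comb-∣ H G c) (cong (_+ wt (comb G c)) (constWt c c≢0))

  heavy : Weights≥ (H ∣ G) (w + D)
  heavy c c≢0 =
    subst (w + D ≤_) (sym (wt-∣ c c≢0)) (+-monoʳ-≤ w (ge (comb G c) (c , refl) (λ eq → c≢0 (li c eq))))

  light : MinWt≤ G D → MinWt≤ (H ∣ G) (w + D)
  light (.(comb G c) , (c , refl) , nz , wt≤D) =
    comb (H ∣ G) c , (c , refl) , (λ eq → nz (comb-∣≡0 H G c eq)) ,
    subst (_≤ w + D) (sym (wt-∣ c (coeff≢0 G nz))) (+-monoʳ-≤ w wt≤D)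

simplex : Vec (Word 7) 3
simplex = (I ∷ O ∷ I ∷ O ∷ I ∷ O ∷ I ∷ [])
        ∷ (O ∷ I ∷ I ∷ O ∷ O ∷ I ∷ I ∷ [])
        ∷ (O ∷ O ∷ O ∷ I ∷ I ∷ I ∷ I ∷ [])
        ∷ []

simplex-constantWeight : ∀ c → c ≢ zero-word 3 → wt (comb simplex c) ≡ 4
simplex-constantWeight = byExhaustion λ c → ¬? (c ≟ʷ _) →-dec (wt (comb simplex c) ≟ 4)

-- Lower bound

⌊4[7+m]/7⌋ : ∀ m → (4 * (7 + m)) / 7 ≡ 4 + (4 * m) / 7
⌊4[7+m]/7⌋ m = trans (cong (_/ 7) (*-distribˡ-+ 4 7 m)) (+-distrib-/-∣ˡ (4 * m) {7} (divides 4 refl))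

⌊4[7+m]/7⌋∸1 : ∀ m → 2 ≤ m → (4 * (7 + m)) / 7 ∸ 1 ≡ 4 + ((4 * m) / 7 ∸ 1)
⌊4[7+m]/7⌋∸1 m 2≤m = trans (cong (_∸ 1) (⌊4[7+m]/7⌋ m)) (+-∸-assoc 4 (m≥n⇒m/n>0 (≤-trans (n≤1+n 7) (*-monoʳ-≤ 4 2≤m))))

dn3-step : ∀ m → 2 ≤ m → dn3 (7 + m) ≡ 4 + dn3 m
dn3-step m 2≤m with m % 7
... | 0 = ⌊4[7+m]/7⌋∸1 m 2≤m
... | 1 = ⌊4[7+m]/7⌋∸1 m 2≤m
... | 2 = ⌊4[7+m]/7⌋∸1 m 2≤m
... | 3 = ⌊4[7+m]/7⌋ m
... | 4 = ⌊4[7+m]/7⌋∸1 m 2≤m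
... | 5 = ⌊4[7+m]/7⌋ m
... | 6 = ⌊4[7+m]/7⌋∸1 m 2≤m
... | suc (suc (suc (suc (suc (suc (suc _)))))) = ⌊4[7+m]/7⌋∸1 m 2≤m

lcdCode : ∀ n → 3 ≤ n → LCDCode n 3 (dn3 n)
lcdCode 0 ()
lcdCode 1 (s≤s ())
lcdCode 2 (s≤s (s≤s ()))
lcdCode 3 _ = lcdCodeByExhaustion
  ( (I ∷ O ∷ O ∷ [])
  ∷ (O ∷ I ∷ O ∷ [])
  ∷ (O ∷ O ∷ I ∷ [])
  ∷ []) 1
lcdCode 4 _ = lcdCodeByExhaustion
  ( (I ∷ O ∷ O ∷ I ∷ [])
  ∷ (O ∷ I ∷ O ∷ I ∷ [])
  ∷ (O ∷ O ∷ I ∷ O ∷ [])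
  ∷ []) 1
lcdCode 5 _ = lcdCodeByExhaustion
  ( (I ∷ I ∷ O ∷ O ∷ I ∷ [])
  ∷ (O ∷ O ∷ I ∷ O ∷ I ∷ [])
  ∷ (O ∷ O ∷ O ∷ I ∷ I ∷ [])
  ∷ []) 2
lcdCode 6 _ = lcdCodeByExhaustion
  ( (I ∷ I ∷ I ∷ O ∷ O ∷ O ∷ [])
  ∷ (O ∷ O ∷ O ∷ I ∷ O ∷ I ∷ [])
  ∷ (O ∷ O ∷ O ∷ O ∷ I ∷ I ∷ [])
  ∷ []) 2
lcdCode 7 _ = lcdCodeByExhaustion
  ( (I ∷ I ∷ O ∷ O ∷ O ∷ I ∷ O ∷ [])
  ∷ (O ∷ O ∷ I ∷ I ∷ O ∷ O ∷ I ∷ [])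
  ∷ (O ∷ O ∷ O ∷ O ∷ I ∷ I ∷ I ∷ [])
  ∷ []) 3
lcdCode 8 _ = lcdCodeByExhaustion
  ( (I ∷ I ∷ I ∷ O ∷ O ∷ O ∷ I ∷ O ∷ [])
  ∷ (O ∷ O ∷ O ∷ I ∷ I ∷ O ∷ O ∷ I ∷ [])
  ∷ (O ∷ O ∷ O ∷ O ∷ O ∷ I ∷ I ∷ I ∷ [])
  ∷ []) 3
lcdCode 9 _ = lcdCodeByExhaustion
  ( (I ∷ I ∷ O ∷ O ∷ O ∷ O ∷ I ∷ I ∷ I ∷ [])
  ∷ (O ∷ O ∷ I ∷ I ∷ O ∷ O ∷ I ∷ O ∷ I ∷ [])
  ∷ (O ∷ O ∷ O ∷ O ∷ I ∷ I ∷ O ∷ I ∷ I ∷ [])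
  ∷ []) 4
lcdCode (suc (suc (suc (suc (suc (suc (suc (suc (suc (suc m)))))))))) _ =
  subst (LCDCode _ 3) (sym (dn3-step (3 + m) (s≤s (s≤s z≤n))))
    (juxtapose-lcd simplex refl simplex-constantWeight (lcdCode (suc (suc (suc m))) (s≤s (s≤s (s≤s z≤n)))))

nonzero3 : Vec (Word 3) 7
nonzero3 = (I ∷ O ∷ O ∷ []) ∷ (O ∷ I ∷ O ∷ []) ∷ (O ∷ O ∷ I ∷ [])
         ∷ (I ∷ I ∷ O ∷ []) ∷ (I ∷ O ∷ I ∷ []) ∷ (O ∷ I ∷ I ∷ []) ∷ (I ∷ I ∷ I ∷ []) ∷ []

nonzero3≢0 : All (_≢ zero-word 3) nonzero3
nonzero3≢0 = (λ ()) ∷ (λ ()) ∷ (λ ()) ∷ (λ ()) ∷ (λ ()) ∷ (λ ()) ∷ (λ ()) ∷ []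

weights : Vec (Word n) 3 → Vec ℕ 7
weights G = map (λ c → wt (comb G c)) nonzero3

sum-zipWith-+ : (u v : Vec ℕ k) → sum (zipWith _+_ u v) ≡ sum u + sum v
sum-zipWith-+ [] [] = refl
sum-zipWith-+ (x ∷ u) (y ∷ v) = trans (cong (x + y +_) (sum-zipWith-+ u v)) (+-interchange x y (sum u) (sum v))

sum-map-+ : (L : ℕ) (e : Vec ℕ k) → sum (map (L +_) e) ≡ k * L + sum e
sum-map-+ L [] = refl
sum-map-+ L (x ∷ e) = trans (cong (L + x +_) (sum-map-+ L e)) (+-interchange L x _ (sum e))

weights-∣ : (H : Vec (Word m) 3) (G : Vec (Word n) 3) → weights (H ∣ G) ≡ zipWith _+_ (weights H) (weights G)
weights-∣ H G = map-cong (wt-comb-∣ H G) nonzero3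

sum-weights≤ : (G : Vec (Word n) 3) → sum (weights G) ≤ 4 * n
sum-weights≤ {zero} ([] ∷ [] ∷ [] ∷ []) = z≤n
sum-weights≤ {suc n} ((x ∷ a) ∷ (y ∷ b) ∷ (z ∷ c) ∷ []) = begin
  sum (weights (column ∣ rest))                      ≡⟨ cong sum (weights-∣ column rest) ⟩
  sum (zipWith _+_ (weights column) (weights rest))  ≡⟨ sum-zipWith-+ (weights column) (weights rest) ⟩
  sum (weights column) + sum (weights rest)          ≤⟨ +-mono-≤ (column≤4 (x ∷ y ∷ z ∷ [])) (sum-weights≤ rest) ⟩
  4 + 4 * n                                          ≡⟨ *-suc 4 n ⟨
  4 * suc n                                          ∎
  where
  open ≤-Reasoning
  column = map [_] (x ∷ y ∷ z ∷ [])
  rest = a ∷ b ∷ c ∷ []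
  column≤4 : ∀ col → sum (weights (map [_] col)) ≤ 4
  column≤4 = byExhaustion λ col → sum (weights (map [_] col)) ≤? 4

excess-decomposition : (xs : Vec ℕ k) → All (L ≤_) xs → map (L +_) (map (_∸ L) xs) ≡ xs
excess-decomposition [] [] = refl
excess-decomposition (x ∷ xs) (L≤x ∷ L≤xs) = cong₂ _∷_ (m+[n∸m]≡n L≤x) (excess-decomposition xs L≤xs)

m≡n*[m/n]+m%n : ∀ m n .{{_ : NonZero n}} → m ≡ n * (m / n) + m % n
m≡n*[m/n]+m%n m n = trans (m≡m%n+[m/n]*n m n) (trans (+-comm (m % n) _) (cong (_+ m % n) (*-comm (m / n) n)))

m<n*[1+m/n] : ∀ m n .{{_ : NonZero n}} → m < n * suc (m / n)
m<n*[1+m/n] m n = begin-strict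
  m                    ≡⟨ m≡n*[m/n]+m%n m n ⟩
  n * (m / n) + m % n  <⟨ +-monoʳ-< (n * (m / n)) (m%n<n m n) ⟩
  n * (m / n) + n      ≡⟨ +-comm (n * (m / n)) n ⟩
  n + n * (m / n)      ≡⟨ *-suc n (m / n) ⟨
  n * suc (m / n)      ∎
  where open ≤-Reasoning

plotkin : (G : Vec (Word n) 3) → ¬ All ((4 * n) / 7 <_) (weights G)
plotkin {n} G heavy = <⇒≱ (m<n*[1+m/n] (4 * n) 7) (begin
  7 * d                          ≤⟨ m≤m+n (7 * d) _ ⟩
  7 * d + sum e                  ≡⟨ sum-map-+ d e ⟨
  sum (map (d +_) e)             ≡⟨ cong sum (excess-decomposition (weights G) heavy) ⟩
  sum (weights G)                ≤⟨ sum-weights≤ G ⟩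
  4 * n                          ∎)
  where
  open ≤-Reasoning
  d = suc ((4 * n) / 7)
  e = map (_∸ d) (weights G)

-- Weights modulo 4 determine the Gram matrix

data ℤ₄ : Set where
  0₄ 1₄ 2₄ 3₄ : ℤ₄

suc₄ : ℤ₄ → ℤ₄
suc₄ 0₄ = 1₄
suc₄ 1₄ = 2₄
suc₄ 2₄ = 3₄
suc₄ 3₄ = 0₄

infixl 6 _+₄_ _-₄_

_+₄_ : ℤ₄ → ℤ₄ → ℤ₄
0₄ +₄ y = y
1₄ +₄ y = suc₄ y
2₄ +₄ y = suc₄ (suc₄ y)
3₄ +₄ y = suc₄ (suc₄ (suc₄ y))

-₄_ : ℤ₄ → ℤ₄
-₄ 0₄ = 0₄
-₄ 1₄ = 3₄
-₄ 2₄ = 2₄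
-₄ 3₄ = 1₄

_-₄_ : ℤ₄ → ℤ₄ → ℤ₄
x -₄ y = x +₄ (-₄ y)

⟦_⟧ : ℕ → ℤ₄
⟦ zero ⟧ = 0₄
⟦ suc n ⟧ = suc₄ ⟦ n ⟧

parity : ℤ₄ → Bool
parity 0₄ = false
parity 1₄ = true
parity 2₄ = false
parity 3₄ = true

twice : Bool → ℤ₄
twice false = 0₄
twice true = 2₄

half : ℤ₄ → Bool
half 0₄ = false
half 1₄ = false
half 2₄ = true
half 3₄ = true

suc₄-period : ∀ x → suc₄ (suc₄ (suc₄ (suc₄ x))) ≡ x
suc₄-period 0₄ = refl
suc₄-period 1₄ = refl
suc₄-period 2₄ = refl
suc₄-period 3₄ = refl

+₄-sucˡ : ∀ x y → suc₄ x +₄ y ≡ suc₄ (x +₄ y)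
+₄-sucˡ 0₄ y = refl
+₄-sucˡ 1₄ y = refl
+₄-sucˡ 2₄ y = refl
+₄-sucˡ 3₄ y = sym (suc₄-period y)

+₄-sucʳ : ∀ x y → x +₄ suc₄ y ≡ suc₄ (x +₄ y)
+₄-sucʳ 0₄ y = refl
+₄-sucʳ 1₄ y = refl
+₄-sucʳ 2₄ y = refl
+₄-sucʳ 3₄ y = refl

+₄-twice-cancel : ∀ x b → (x +₄ twice b) -₄ x ≡ twice b
+₄-twice-cancel 0₄ false = refl
+₄-twice-cancel 0₄ true = refl
+₄-twice-cancel 1₄ false = refl
+₄-twice-cancel 1₄ true = refl
+₄-twice-cancel 2₄ false = refl
+₄-twice-cancel 2₄ true = refl
+₄-twice-cancel 3₄ false = refl
+₄-twice-cancel 3₄ true = refl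

half-twice : ∀ b → half (twice b) ≡ b
half-twice false = refl
half-twice true = refl

twice-not : ∀ b → twice (not b) ≡ suc₄ (suc₄ (twice b))
twice-not false = refl
twice-not true = refl

parity-twice : ∀ b → parity (twice b) ≡ false
parity-twice false = refl
parity-twice true = refl

parity-suc₄ : ∀ x → parity (suc₄ x) ≡ not (parity x)
parity-suc₄ 0₄ = refl
parity-suc₄ 1₄ = refl
parity-suc₄ 2₄ = refl
parity-suc₄ 3₄ = refl

⟦+⟧ : ∀ m n → ⟦ m + n ⟧ ≡ ⟦ m ⟧ +₄ ⟦ n ⟧
⟦+⟧ zero n = refl
⟦+⟧ (suc m) n = trans (cong suc₄ (⟦+⟧ m n)) (sym (+₄-sucˡ ⟦ m ⟧ ⟦ n ⟧))

⟦q*4+r⟧ : ∀ q r → ⟦ q * 4 + r ⟧ ≡ ⟦ r ⟧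
⟦q*4+r⟧ zero r = refl
⟦q*4+r⟧ (suc q) r = trans (suc₄-period ⟦ q * 4 + r ⟧) (⟦q*4+r⟧ q r)

⟦wt⟧-⊕ : (x y : Word n) → ⟦ wt x ⟧ +₄ ⟦ wt y ⟧ ≡ ⟦ wt (x ⊕ y) ⟧ +₄ twice (x · y)
⟦wt⟧-⊕ [] [] = refl
⟦wt⟧-⊕ (O ∷ x) (O ∷ y) = ⟦wt⟧-⊕ x y
⟦wt⟧-⊕ (I ∷ x) (O ∷ y) = begin
  suc₄ ⟦ wt x ⟧ +₄ ⟦ wt y ⟧                ≡⟨ +₄-sucˡ ⟦ wt x ⟧ ⟦ wt y ⟧ ⟩
  suc₄ (⟦ wt x ⟧ +₄ ⟦ wt y ⟧)              ≡⟨ cong suc₄ (⟦wt⟧-⊕ x y) ⟩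
  suc₄ (⟦ wt (x ⊕ y) ⟧ +₄ twice (x · y))   ≡⟨ +₄-sucˡ ⟦ wt (x ⊕ y) ⟧ (twice (x · y)) ⟨
  suc₄ ⟦ wt (x ⊕ y) ⟧ +₄ twice (x · y)     ∎
  where open ≡-Reasoning
⟦wt⟧-⊕ (O ∷ x) (I ∷ y) = begin
  ⟦ wt x ⟧ +₄ suc₄ ⟦ wt y ⟧                ≡⟨ +₄-sucʳ ⟦ wt x ⟧ ⟦ wt y ⟧ ⟩
  suc₄ (⟦ wt x ⟧ +₄ ⟦ wt y ⟧)              ≡⟨ cong suc₄ (⟦wt⟧-⊕ x y) ⟩
  suc₄ (⟦ wt (x ⊕ y) ⟧ +₄ twice (x · y))   ≡⟨ +₄-sucˡ ⟦ wt (x ⊕ y) ⟧ (twice (x · y)) ⟨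
  suc₄ ⟦ wt (x ⊕ y) ⟧ +₄ twice (x · y)     ∎
  where open ≡-Reasoning
⟦wt⟧-⊕ (I ∷ x) (I ∷ y) = begin
  suc₄ ⟦ wt x ⟧ +₄ suc₄ ⟦ wt y ⟧                 ≡⟨ +₄-sucˡ ⟦ wt x ⟧ (suc₄ ⟦ wt y ⟧) ⟩
  suc₄ (⟦ wt x ⟧ +₄ suc₄ ⟦ wt y ⟧)               ≡⟨ cong suc₄ (+₄-sucʳ ⟦ wt x ⟧ ⟦ wt y ⟧) ⟩
  suc₄ (suc₄ (⟦ wt x ⟧ +₄ ⟦ wt y ⟧))             ≡⟨ cong (suc₄ ∘ suc₄) (⟦wt⟧-⊕ x y) ⟩
  suc₄ (suc₄ (⟦ wt (x ⊕ y) ⟧ +₄ twice (x · y)))  ≡⟨ cong suc₄ (+₄-sucʳ ⟦ wt (x ⊕ y) ⟧ (twice (x · y))) ⟨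
  suc₄ (⟦ wt (x ⊕ y) ⟧ +₄ suc₄ (twice (x · y)))  ≡⟨ +₄-sucʳ ⟦ wt (x ⊕ y) ⟧ (suc₄ (twice (x · y))) ⟨
  ⟦ wt (x ⊕ y) ⟧ +₄ suc₄ (suc₄ (twice (x · y)))  ≡⟨ cong (⟦ wt (x ⊕ y) ⟧ +₄_) (twice-not (x · y)) ⟨
  ⟦ wt (x ⊕ y) ⟧ +₄ twice (not (x · y))          ∎
  where open ≡-Reasoning

overlap₄ : ℤ₄ → ℤ₄ → ℤ₄ → ℤ₄
overlap₄ x y z = (x +₄ y) -₄ z

overlap₄-wt : (x y : Word n) → overlap₄ ⟦ wt x ⟧ ⟦ wt y ⟧ ⟦ wt (x ⊕ y) ⟧ ≡ twice (x · y)
overlap₄-wt x y =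
  trans (cong (_-₄ ⟦ wt (x ⊕ y) ⟧) (⟦wt⟧-⊕ x y)) (+₄-twice-cancel ⟦ wt (x ⊕ y) ⟧ (x · y))

·-fromWeights : (x y : Word n) → x · y ≡ half (overlap₄ ⟦ wt x ⟧ ⟦ wt y ⟧ ⟦ wt (x ⊕ y) ⟧)
·-fromWeights x y = trans (sym (half-twice (x · y))) (cong half (sym (overlap₄-wt x y)))

overlap₄-even : (x y : Word n) → parity (overlap₄ ⟦ wt x ⟧ ⟦ wt y ⟧ ⟦ wt (x ⊕ y) ⟧) ≡ false
overlap₄-even x y = trans (cong parity (overlap₄-wt x y)) (parity-twice (x · y))

·-self : (x : Word n) → x · x ≡ parity ⟦ wt x ⟧
·-self [] = refl
·-self (O ∷ x) = ·-self x
·-self (I ∷ x) = trans (cong not (·-self x)) (sym (parity-suc₄ ⟦ wt x ⟧))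

dot₄ : ℤ₄ → ℤ₄ → ℤ₄ → Bool
dot₄ x y z = half (overlap₄ x y z)

-- The residues are those of the weights of a, b, c, a ⊕ b, a ⊕ c, b ⊕ c, a ⊕ b ⊕ c (cf. nonzero3).
gramFromResidues : Vec ℤ₄ 7 → Vec (Word 3) 3
gramFromResidues (ra ∷ rb ∷ rc ∷ rab ∷ rac ∷ rbc ∷ _ ∷ []) =
    (parity ra ∷ dot₄ ra rb rab ∷ dot₄ ra rc rac ∷ [])
  ∷ (dot₄ ra rb rab ∷ parity rb ∷ dot₄ rb rc rbc ∷ [])
  ∷ (dot₄ ra rc rac ∷ dot₄ rb rc rbc ∷ parity rc ∷ [])
  ∷ []

Gram≡gramFromResidues : (G : Vec (Word n) 3) → Gram G ≡ gramFromResidues (map ⟦_⟧ (weights G))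
Gram≡gramFromResidues (a ∷ b ∷ c ∷ []) rewrite ⊕-identityʳ a | ⊕-identityʳ b | ⊕-identityʳ c =
  cong₂ _∷_ (row (·-self a) (·-fromWeights a b) (·-fromWeights a c))
  (cong₂ _∷_ (row (trans (·-comm b a) (·-fromWeights a b)) (·-self b) (·-fromWeights b c))
  (cong₂ _∷_ (row (trans (·-comm c a) (·-fromWeights a c)) (trans (·-comm c b) (·-fromWeights b c)) (·-self c))
  refl))
  where
  row : ∀ {x y z x′ y′ z′} → x ≡ x′ → y ≡ y′ → z ≡ z′ → (x ∷ y ∷ z ∷ []) ≡ (x′ ∷ y′ ∷ z′ ∷ [])
  row refl refl refl = refl

-- Residue vectors violating these parities (wt x + wt y − wt (x ⊕ y) = 2 |x ∧ y|) are not weights of a code.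
Consistent : Vec ℤ₄ 7 → Set
Consistent (ra ∷ rb ∷ rc ∷ rab ∷ rac ∷ rbc ∷ _ ∷ []) =
  parity (overlap₄ ra rb rab) ≡ false × parity (overlap₄ ra rc rac) ≡ false × parity (overlap₄ rb rc rbc) ≡ false

consistent? : Decidable Consistent
consistent? (ra ∷ rb ∷ rc ∷ rab ∷ rac ∷ rbc ∷ _ ∷ []) =
  (parity (overlap₄ ra rb rab) ≟ᵇ false) ×-dec (parity (overlap₄ ra rc rac) ≟ᵇ false) ×-dec (parity (overlap₄ rb rc rbc) ≟ᵇ false)

weights-consistent : (G : Vec (Word n) 3) → Consistent (map ⟦_⟧ (weights G))
weights-consistent (a ∷ b ∷ c ∷ []) rewrite ⊕-identityʳ a | ⊕-identityʳ b | ⊕-identityʳ c =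
  overlap₄-even a b , overlap₄-even a c , overlap₄-even b c

-- Small slack forces a singular Gram matrix

slackResidues : ℕ → Vec ℕ 7 → Vec ℤ₄ 7
slackResidues S e = map (λ x → ⟦ S + x ⟧) e

slackCase : ℕ → Vec ℕ 7 → Bool
slackCase S e = isYes (consistent? (slackResidues S e) →-dec singular? (gramFromResidues (slackResidues S e)))

slackCheck : T (allUpTo 4 λ S → allWithSum≤ 7 S (slackCase S))
slackCheck = tt

singular-slack : ∀ S (e : Vec ℕ 7) → S ≤ 4 → sum e ≤ S →
  Consistent (slackResidues S e) → Singular (gramFromResidues (slackResidues S e))
singular-slack S e S≤4 e≤S consistent =
  satisfied (toWitness {a? = consistent? _ →-dec singular? _}
    (allWithSum≤-sound 7 S {slackCase S} e (allUpTo-sound 4 {λ S → allWithSum≤ 7 S (slackCase S)} slackCheck S≤4) e≤S) consistent)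

gram-singular : (G : Vec (Word n) 3) (L S : ℕ) → S ≤ 4 → 4 * n ≡ 7 * L + S → All (L ≤_) (weights G) → Singular (Gram G)
gram-singular {n} G L S S≤4 4n≡7L+S heavy =
  subst Singular (sym Gram≡) (singular-slack S e S≤4 sum-e≤S (subst Consistent residues≡ (weights-consistent G)))
  where
  e = map (_∸ L) (weights G)

  sum-e≤S : sum e ≤ S
  sum-e≤S = +-cancelˡ-≤ (7 * L) (sum e) S (begin
    7 * L + sum e         ≡⟨ sum-map-+ L e ⟨
    sum (map (L +_) e)    ≡⟨ cong sum (excess-decomposition (weights G) heavy) ⟩
    sum (weights G)       ≤⟨ sum-weights≤ G ⟩
    4 * n                 ≡⟨ 4n≡7L+S ⟩
    7 * L + S             ∎)
    where open ≤-Reasoning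

  ⟦L⟧≡⟦S⟧ : ⟦ L ⟧ ≡ ⟦ S ⟧
  ⟦L⟧≡⟦S⟧ = begin
    ⟦ L ⟧                 ≡⟨ ⟦q*4+r⟧ n L ⟨
    ⟦ n * 4 + L ⟧         ≡⟨ cong (λ m → ⟦ m + L ⟧) (trans (*-comm n 4) 4n≡7L+S) ⟩
    ⟦ 7 * L + S + L ⟧     ≡⟨ cong ⟦_⟧ (rearrange L S) ⟩
    ⟦ 2 * L * 4 + S ⟧     ≡⟨ ⟦q*4+r⟧ (2 * L) S ⟩
    ⟦ S ⟧                 ∎
    where
    open ≡-Reasoning
    rearrange : ∀ L S → 7 * L + S + L ≡ 2 * L * 4 + S
    rearrange = solve-∀

  residues≡ : map ⟦_⟧ (weights G) ≡ slackResidues S e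
  residues≡ = begin
    map ⟦_⟧ (weights G)           ≡⟨ cong (map ⟦_⟧) (excess-decomposition (weights G) heavy) ⟨
    map ⟦_⟧ (map (L +_) e)        ≡⟨ map-∘ ⟦_⟧ (L +_) e ⟨
    map (λ x → ⟦ L + x ⟧) e       ≡⟨ map-cong (λ x → trans (⟦+⟧ L x) (trans (cong (_+₄ ⟦ x ⟧) ⟦L⟧≡⟦S⟧) (sym (⟦+⟧ S x)))) e ⟩
    map (λ x → ⟦ S + x ⟧) e       ∎
    where open ≡-Reasoning

  Gram≡ : Gram G ≡ gramFromResidues (slackResidues S e)
  Gram≡ = trans (Gram≡gramFromResidues G) (cong gramFromResidues residues≡)

lcd⇒¬weights≥ : (G : Vec (Word n) 3) → LinIndep G → IsLCD G → (L S : ℕ) → S ≤ 4 → 4 * n ≡ 7 * L + S →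
  ¬ All (L ≤_) (weights G)
lcd⇒¬weights≥ G li lcd L S S≤4 4n≡7L+S heavy with gram-singular G L S S≤4 4n≡7L+S heavy
... | c , c≢0 , Gram·c≡0 = c≢0 (lcd⇒nonsingular G li lcd c Gram·c≡0)

-- Upper bound

minWt≤⊎weights> : (G : Vec (Word n) k) → LinIndep G → (D : ℕ) (cs : Vec (Word k) m) → All (_≢ zero-word k) cs →
  MinWt≤ G D ⊎ All (λ c → D < wt (comb G c)) cs
minWt≤⊎weights> G li D [] [] = inj₂ []
minWt≤⊎weights> G li D (c ∷ cs) (c≢0 ∷ cs≢0) with wt (comb G c) ≤? D
... | yes light = inj₁ (light⇒minWt≤ G li c c≢0 light)
... | no ¬light = map₂ (≰⇒> ¬light ∷_) (minWt≤⊎weights> G li D cs cs≢0)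

slack≤4 : ∀ n {r} → n % 7 ≡ r → {T ((4 * r) % 7 ≤ᵇ 4)} → (4 * n) % 7 ≤ 4
slack≤4 n {r} eq {ok} = subst (_≤ 4) (sym (trans (%-distribˡ-* 4 n 7) (cong (λ x → (4 * x) % 7) eq))) (≤ᵇ⇒≤ _ 4 ok)

dn3-cases : ∀ n → dn3 n ≡ (4 * n) / 7 ⊎ (dn3 n ≡ (4 * n) / 7 ∸ 1 × (4 * n) % 7 ≤ 4)
dn3-cases n with n % 7 in eq | m%n<n n 7
... | 0 | _ = inj₂ (refl , slack≤4 n eq)
... | 1 | _ = inj₂ (refl , slack≤4 n eq)
... | 2 | _ = inj₂ (refl , slack≤4 n eq)
... | 3 | _ = inj₁ refl
... | 4 | _ = inj₂ (refl , slack≤4 n eq)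
... | 5 | _ = inj₁ refl
... | 6 | _ = inj₂ (refl , slack≤4 n eq)
... | suc (suc (suc (suc (suc (suc (suc _)))))) | s≤s (s≤s (s≤s (s≤s (s≤s (s≤s (s≤s ()))))))

∸1<⇒≤ : ∀ {m w} → m ∸ 1 < w → m ≤ w
∸1<⇒≤ {zero} _ = z≤n
∸1<⇒≤ {suc m} m<w = m<w

¬weights>dn3 : (G : Vec (Word n) 3) → LinIndep G → IsLCD G → ¬ All (dn3 n <_) (weights G)
¬weights>dn3 {n} G li lcd heavy with dn3-cases n
... | inj₁ dn3≡ = plotkin G (subst (λ D → All (D <_) (weights G)) dn3≡ heavy)
... | inj₂ (dn3≡ , small) =
  lcd⇒¬weights≥ G li lcd ((4 * n) / 7) ((4 * n) % 7) small (m≡n*[m/n]+m%n (4 * n) 7) (All.map ⌊4n/7⌋≤ heavy)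
  where
  ⌊4n/7⌋≤ : ∀ {w} → dn3 n < w → (4 * n) / 7 ≤ w
  ⌊4n/7⌋≤ {w} h = ∸1<⇒≤ (subst (_< w) dn3≡ h)

lcd-minWt≤dn3 : (G : Vec (Word n) 3) → LinIndep G → IsLCD G → MinWt≤ G (dn3 n)
lcd-minWt≤dn3 {n} G li lcd with minWt≤⊎weights> G li (dn3 n) nonzero3 nonzero3≢0
... | inj₁ light = light
... | inj₂ heavy = ⊥-elim (¬weights>dn3 G li lcd (map⁺ {f = λ c → wt (comb G c)} heavy))

theorem5p1 : (n : ℕ) → 3 ≤ n → IsLCDOptimal n 3 (dn3 n)
theorem5p1 n 3≤n = lcdCode n 3≤n , lcd-minWt≤dn3
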